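{- Let $k\ge 0$ and let $a(n)=\binom{n}{\lfloor n/2\rfloor}$ for $n\ge 0$. Then $$F_{k+2}(1,-x^2)-xF_{k+1}(1,-x^2)=\det\begin{pmatrix} a(0)&a(1)&\cdots&a(k)&x^{k+1}\\ a(1)&a(2)&\cdots&a(k+1)&x^{k}\\ \vdots&\vdots&\ddots&\vdots&\vdots\\ a(k)&a(k+1)&\cdots&a(2k)&x\\ a(k+1)&a(k+2)&\cdots&a(2k+1)&1\end{pmatrix},$$ i.e. the $(k+2)\times(k+2)$ matrix whose row $i$ ($0\le i\le k+1$) is $(a(i),a(i+1),\dots,a(i+k),x^{k+1-i})$.
   Context: The Fibonacci polynomials are $F_n(x,s)=\sum_{j=0}^{\lfloor (n-1)/2\rfloor}\binom{n-1-j}{j}x^{n-1-2j}s^j$ for $n\ge 1$, $F_0(x,s)=0$; they satisfy $F_n=xF_{n-1}+sF_{n-2}$. -}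

module Defs where

open import Level using (Level)
open import Data.Nat as ℕ using (ℕ; zero; suc; _∸_; _/_; _<ᵇ_)
open import Data.Nat.Combinatorics using (_C_)
open import Data.Fin using (Fin; toℕ; punchIn) renaming (zero to fzero; suc to fsuc)
open import Data.Bool using (if_then_else_)
open import Algebra.Bundles using (CommutativeRing)

module _ {c ℓ : Level} (R : CommutativeRing c ℓ) where
  open CommutativeRing R using (Carrier; _+_; _*_; -_; 0#; 1#)

  _^_ : Carrier → ℕ → Carrier
  x ^ zero  = 1#
  x ^ suc n = x * (x ^ n)

  _×_ : ℕ → Carrier → Carrier
  zero  × r = 0#
  suc n × r = r + (n × r)

  sumTo : ℕ → (ℕ → Carrier) → Carrier
  sumTo zero    f = f zero
  sumTo (suc m) f = sumTo m f + f (suc m)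

  Fib : ℕ → Carrier → Carrier → Carrier
  Fib zero    x s = 0#
  Fib (suc m) x s =
    sumTo (m / 2) (λ j → ((m ∸ j) C j) × ((x ^ (m ∸ (2 ℕ.* j))) * (s ^ j)))

  sign : ℕ → Carrier
  sign zero    = 1#
  sign (suc j) = - sign j

  sumFin : (n : ℕ) → (Fin n → Carrier) → Carrier
  sumFin zero    f = 0#
  sumFin (suc n) f = f fzero + sumFin n (λ j → f (fsuc j))

  det : (n : ℕ) → (Fin n → Fin n → Carrier) → Carrier
  det zero    M = 1#
  det (suc n) M =
    sumFin (suc n) (λ j → (sign (toℕ j) * M fzero j)
                          * det n (λ r c' → M (fsuc r) (punchIn j c')))

  a : ℕ → Carrier
  a n = (n C (n / 2)) × 1#

  hankelMatrix : (k : ℕ) → Carrier → Fin (suc (suc k)) → Fin (suc (suc k)) → Carrier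
  hankelMatrix k x i j =
    if toℕ j <ᵇ suc k then a (toℕ i ℕ.+ toℕ j) else x ^ (suc k ∸ toℕ i)

-- The central binomial coefficients a(n) count walks on ℕ with a loop at 0, so they are the
-- moments of a linear functional ℒ whose monic orthogonal polynomials satisfy π₀ = 1, π₁ = t − 1,
-- πₙ₊₂ = t πₙ₊₁ − πₙ, with ℒ(tʲ πₙ) = 0 for j < n and ℒ(tⁿ πₙ) = 1. Adding to the last row of the
-- bordered Hankel matrix the combination of all rows with the coefficients of π_{k+1} turns it into
-- (0, …, 0, Σᵢ π_{k+1,i} x^{k+1−i}); hence the determinant is this sum times the Hankel determinant
-- det (a(i+j)) = 1 (by the same argument). The sum, as a function of k, satisfies
-- wₙ₊₂ = wₙ₊₁ − x² wₙ, which is also the recurrence of Fₙ₊₂(1,−x²) − x Fₙ₊₁(1,−x²), and the initial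
-- values agree.

module Submission where

open import Defs
open import Level using (Level; _⊔_)
open import Data.Nat using (ℕ; suc)
open import Algebra.Bundles using (CommutativeRing)
open import Data.Fin.Base using (toℕ)
open import Data.Nat.Base using (_∸_)

module CentralBinomial where
  open import Data.Nat.Base using (zero; _+_; _∸_; _<_; ⌊_/2⌋; ⌈_/2⌉; s≤s; z≤n)
  open import Data.Nat.Properties
    using ( +-suc; +-comm; +-∸-assoc; m+n∸m≡n; m≤n⇒m∸n≡0; ≤-reflexive; ≤-trans; <⇒≤; <-≤-trans; ≤-<-connex
          ; m<n⇒m<1+n; n<1+n; n≤1+n; +-mono-<-≤; m<n+o⇒m∸n<o; ⌊n/2⌋-mono; ⌊n/2⌋≤n; ⌊n/2⌋+⌈n/2⌉≡n
          ; module ≤-Reasoning )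
  open import Data.Nat.Combinatorics using (_C_; nCk+nC[k+1]≡[n+1]C[k+1]; nCk≡nC[n∸k]; k>n⇒nCk≡0)
  open import Data.Nat.DivMod using (_/_; m/n≡1+[m∸n]/n)
  open import Relation.Binary.PropositionalEquality
    using (_≡_; refl; sym; trans; cong; cong₂; subst; module ≡-Reasoning)
  open import Data.Sum.Base using (inj₁; inj₂)

  -- paths n h counts walks of n steps ±1 from height 0 to height h, where a down step at height 0 stays at 0.
  paths : ℕ → ℕ → ℕ
  paths zero    zero    = 1
  paths zero    (suc h) = 0
  paths (suc n) zero    = paths n 0 + paths n 1
  paths (suc n) (suc h) = paths n h + paths n (suc (suc h))

  paths-< : ∀ {n h} → n < h → paths n h ≡ 0
  paths-< {zero}  {suc h} _         = refl
  paths-< {suc n} {suc h} (s≤s n<h) =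
    cong₂ _+_ (paths-< n<h) (paths-< (m<n⇒m<1+n (m<n⇒m<1+n n<h)))

  paths-diagonal : ∀ n → paths n n ≡ 1
  paths-diagonal zero    = refl
  paths-diagonal (suc n) = cong₂ _+_ (paths-diagonal n) (paths-< (m<n⇒m<1+n (n<1+n n)))

  C⌊n/2⌋≡C⌈n/2⌉ : ∀ n → n C ⌊ n /2⌋ ≡ n C ⌈ n /2⌉
  C⌊n/2⌋≡C⌈n/2⌉ n = trans (nCk≡nC[n∸k] (⌊n/2⌋≤n n)) (cong (n C_) n∸⌊n/2⌋≡⌈n/2⌉)
    where
    n∸⌊n/2⌋≡⌈n/2⌉ : n ∸ ⌊ n /2⌋ ≡ ⌈ n /2⌉
    n∸⌊n/2⌋≡⌈n/2⌉ =
      subst (λ m → m ∸ ⌊ n /2⌋ ≡ ⌈ n /2⌉) (⌊n/2⌋+⌈n/2⌉≡n n) (m+n∸m≡n ⌊ n /2⌋ ⌈ n /2⌉)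

  -- A walk ending at h with e surplus steps makes ⌊e/2⌋ down steps (flat steps at 0 count as down).
  paths-binomial : ∀ e h → paths (h + e) h ≡ (h + e) C ⌊ e /2⌋
  paths-binomial zero h rewrite +-comm h 0 = paths-diagonal h
  paths-binomial (suc zero) zero = refl
  paths-binomial (suc zero) (suc h) = cong₂ _+_ (paths-binomial 1 h) (paths-< (s≤s (≤-reflexive (+-comm h 1))))
  paths-binomial (suc (suc e)) zero = begin
    paths (suc e) 0 + paths (suc e) 1              ≡⟨ cong₂ _+_ (paths-binomial (suc e) 0) (paths-binomial e 1) ⟩
    suc e C ⌊ suc e /2⌋ + suc e C ⌊ e /2⌋           ≡⟨ cong (_+ suc e C ⌊ e /2⌋) (C⌊n/2⌋≡C⌈n/2⌉ (suc e)) ⟩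
    suc e C suc ⌊ e /2⌋ + suc e C ⌊ e /2⌋           ≡⟨ +-comm (suc e C suc ⌊ e /2⌋) _ ⟩
    suc e C ⌊ e /2⌋ + suc e C suc ⌊ e /2⌋           ≡⟨ nCk+nC[k+1]≡[n+1]C[k+1] (suc e) ⌊ e /2⌋ ⟩
    suc (suc e) C suc ⌊ e /2⌋                       ∎
    where open ≡-Reasoning
  paths-binomial (suc (suc e)) (suc h) = begin
    paths n h + paths n (suc (suc h))
      ≡⟨ cong₂ _+_ (paths-binomial (suc (suc e)) h)
                   (trans (cong (λ m → paths m (suc (suc h))) n≡) (paths-binomial e (suc (suc h)))) ⟩
    n C suc k + suc (suc (h + e)) C k   ≡⟨ cong (λ m → n C suc k + m C k) (sym n≡) ⟩
    n C suc k + n C k                   ≡⟨ +-comm (n C suc k) (n C k) ⟩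
    n C k + n C suc k                   ≡⟨ nCk+nC[k+1]≡[n+1]C[k+1] n k ⟩
    suc n C suc k                       ∎
    where
    open ≡-Reasoning
    n = h + suc (suc e)
    k = ⌊ e /2⌋
    n≡ : n ≡ suc (suc (h + e))
    n≡ = trans (+-suc h (suc e)) (cong suc (+-suc h e))

  n/2≡⌊n/2⌋ : ∀ n → n / 2 ≡ ⌊ n /2⌋
  n/2≡⌊n/2⌋ zero          = refl
  n/2≡⌊n/2⌋ (suc zero)    = refl
  n/2≡⌊n/2⌋ (suc (suc n)) = trans (m/n≡1+[m∸n]/n {suc (suc n)} (s≤s (s≤s z≤n))) (cong suc (n/2≡⌊n/2⌋ n))

  paths-central : ∀ n → paths n 0 ≡ n C (n / 2)
  paths-central n = trans (paths-binomial n 0) (cong (n C_) (sym (n/2≡⌊n/2⌋ n)))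


  ⌊m/2⌋<j⇒m∸j<j : ∀ m j → ⌊ m /2⌋ < j → m ∸ j < j
  ⌊m/2⌋<j⇒m∸j<j m (suc j) ⌊m/2⌋<j = m<n+o⇒m∸n<o m (suc j) (begin-strict
    m                    ≡⟨ ⌊n/2⌋+⌈n/2⌉≡n m ⟨
    ⌊ m /2⌋ + ⌈ m /2⌉    <⟨ +-mono-<-≤ ⌊m/2⌋<j (≤-trans (⌊n/2⌋-mono (n≤1+n (suc m))) ⌊m/2⌋<j) ⟩
    suc j + suc j        ∎)
    where open ≤-Reasoning

  [1+m∸j]C[1+j] : ∀ m j → (suc m ∸ j) C suc j ≡ (m ∸ j) C j + (m ∸ j) C suc j
  [1+m∸j]C[1+j] m j with ≤-<-connex j m
  ... | inj₁ j≤m rewrite +-∸-assoc 1 j≤m = sym (nCk+nC[k+1]≡[n+1]C[k+1] (m ∸ j) j)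
  ... | inj₂ m<j rewrite m≤n⇒m∸n≡0 m<j | m≤n⇒m∸n≡0 (<⇒≤ m<j) =
    trans (k>n⇒nCk≡0 {0} {suc j} (s≤s z≤n))
          (sym (cong₂ _+_ (k>n⇒nCk≡0 {0} {j} (<-≤-trans (s≤s z≤n) m<j)) (k>n⇒nCk≡0 {0} {suc j} (s≤s z≤n))))

open CentralBinomial using (paths; paths-<; paths-diagonal; paths-central; n/2≡⌊n/2⌋; ⌊m/2⌋<j⇒m∸j<j; [1+m∸j]C[1+j])

module PunchIn where
  open import Data.Nat.Base using (ℕ; suc)
  open import Data.Fin.Base using (Fin; punchIn; inject₁; fromℕ) renaming (zero to fzero; suc to fsuc)
  open import Relation.Binary.PropositionalEquality using (_≡_; refl; cong)

  punchIn-fromℕ : ∀ n (c : Fin n) → punchIn (fromℕ n) c ≡ inject₁ c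
  punchIn-fromℕ (suc n) fzero    = refl
  punchIn-fromℕ (suc n) (fsuc c) = cong fsuc (punchIn-fromℕ n c)

  punchIn-inject₁ : ∀ n (i : Fin (suc n)) (j : Fin n) → punchIn (inject₁ i) (inject₁ j) ≡ inject₁ (punchIn i j)
  punchIn-inject₁ n       fzero    j        = refl
  punchIn-inject₁ (suc n) (fsuc i) fzero    = refl
  punchIn-inject₁ (suc n) (fsuc i) (fsuc j) = cong fsuc (punchIn-inject₁ n i j)

  punchIn-inject₁-fromℕ : ∀ n (i : Fin (suc n)) → punchIn (inject₁ i) (fromℕ n) ≡ fromℕ (suc n)
  punchIn-inject₁-fromℕ n       fzero    = refl
  punchIn-inject₁-fromℕ (suc n) (fsuc i) = cong fsuc (punchIn-inject₁-fromℕ n i)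

open PunchIn

-- The ring solver with integer coefficients, which (unlike the natural-number instance) cancels x - x.
module ℤ-Solver {c ℓ : Level} (R : CommutativeRing c ℓ) where
  open CommutativeRing R
  open import Algebra.Properties.Ring ring using (-‿distribˡ-*; -‿distribʳ-*; -‿+-comm; -‿involutive; -0#≈0#)
  open import Algebra.Properties.CommutativeSemigroup +-commutativeSemigroup using (interchange)
  import Algebra.Properties.Semiring.Mult.TCOptimised semiring as Mult
  open Mult using (×-homo-+; ×1-homo-*; 1+×)
  open import Algebra.Solver.Ring.AlmostCommutativeRing
    using (AlmostCommutativeRing; fromCommutativeRing; _-Raw-AlmostCommutative⟶_)
  open import Data.Integer.Base as ℤ using (ℤ; +_; -[1+_]; _⊖_)
  import Data.Integer.Properties as ℤ
  open import Data.Nat.Base as ℕ using (zero; suc; z≤n)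
  open import Data.Nat.Properties using (+-suc)
  open import Data.Maybe.Base using (Maybe; just; nothing)
  open import Relation.Nullary.Decidable using (yes; no)
  open import Relation.Binary.PropositionalEquality using (cong) renaming (refl to ≡-refl)
  open import Relation.Binary.Reasoning.Setoid setoid

  -- The optimised _×_ makes the constants +1 and -1 denote 1# and - 1# definitionally.
  fromℤ : ℤ → Carrier
  fromℤ (+ n)    = n Mult.× 1#
  fromℤ -[1+ n ] = - (suc n Mult.× 1#)

  private
    1+x-[1+y]≈x-y : ∀ x y → (1# + x) - (1# + y) ≈ x - y
    1+x-[1+y]≈x-y x y = begin
      (1# + x) - (1# + y)       ≈⟨ +-congˡ (-‿+-comm 1# y) ⟨
      (1# + x) + (- 1# + - y)   ≈⟨ interchange 1# x (- 1#) (- y) ⟩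
      (1# - 1#) + (x - y)       ≈⟨ +-congʳ (-‿inverseʳ 1#) ⟩
      0# + (x - y)              ≈⟨ +-identityˡ _ ⟩
      x - y                     ∎

    -x*-y≈x*y : ∀ x y → - x * - y ≈ x * y
    -x*-y≈x*y x y = begin
      - x * - y     ≈⟨ -‿distribˡ-* x (- y) ⟨
      - (x * - y)   ≈⟨ -‿cong (-‿distribʳ-* x y) ⟨
      - - (x * y)   ≈⟨ -‿involutive (x * y) ⟩
      x * y         ∎

  fromℤ-⊖ : ∀ m n → fromℤ (m ⊖ n) ≈ m Mult.× 1# - n Mult.× 1#
  fromℤ-⊖ m       zero    = trans (reflexive (cong fromℤ (ℤ.⊖-≥ {m} z≤n))) (sym (trans (+-congˡ -0#≈0#) (+-identityʳ _)))
  fromℤ-⊖ zero    (suc n) = sym (+-identityˡ _)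
  fromℤ-⊖ (suc m) (suc n) = begin
    fromℤ (suc m ⊖ suc n)               ≡⟨ cong fromℤ (ℤ.[1+m]⊖[1+n]≡m⊖n m n) ⟩
    fromℤ (m ⊖ n)                       ≈⟨ fromℤ-⊖ m n ⟩
    m Mult.× 1# - n Mult.× 1#                     ≈⟨ 1+x-[1+y]≈x-y _ _ ⟨
    (1# + m Mult.× 1#) - (1# + n Mult.× 1#)       ≈⟨ +-cong (1+× m 1#) (-‿cong (1+× n 1#)) ⟨
    suc m Mult.× 1# - suc n Mult.× 1#             ∎

  fromℤ-homo-+ : ∀ i j → fromℤ (i ℤ.+ j) ≈ fromℤ i + fromℤ j
  fromℤ-homo-+ (+ m)    (+ n)    = ×-homo-+ 1# m n
  fromℤ-homo-+ (+ m)    -[1+ n ] = fromℤ-⊖ m (suc n)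
  fromℤ-homo-+ -[1+ m ] (+ n)    = trans (fromℤ-⊖ n (suc m)) (+-comm _ _)
  fromℤ-homo-+ -[1+ m ] -[1+ n ] = begin
    - (suc (suc (m ℕ.+ n)) Mult.× 1#)  ≡⟨ cong (λ k → - (suc k Mult.× 1#)) (+-suc m n) ⟨
    - ((suc m ℕ.+ suc n) Mult.× 1#)    ≈⟨ -‿cong (×-homo-+ 1# (suc m) (suc n)) ⟩
    - (suc m Mult.× 1# + suc n Mult.× 1#)               ≈⟨ -‿+-comm _ _ ⟨
    - (suc m Mult.× 1#) + - (suc n Mult.× 1#)           ∎

  fromℤ-homo-* : ∀ i j → fromℤ (i ℤ.* j) ≈ fromℤ i * fromℤ j
  fromℤ-homo-* (+ zero)    j          = sym (zeroˡ _)
  fromℤ-homo-* (+ suc m)   (+ zero)   = trans (reflexive (cong fromℤ (ℤ.*-zeroʳ (+ suc m)))) (sym (zeroʳ _))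
  fromℤ-homo-* (+ suc m)   (+ suc n)  = ×1-homo-* (suc m) (suc n)
  fromℤ-homo-* (+ suc m)   -[1+ n ]   = trans (-‿cong (×1-homo-* (suc m) (suc n))) (-‿distribʳ-* _ _)
  fromℤ-homo-* -[1+ m ]    (+ zero)   = trans (reflexive (cong fromℤ (ℤ.*-zeroʳ -[1+ m ]))) (sym (zeroʳ _))
  fromℤ-homo-* -[1+ m ]    (+ suc n)  = trans (-‿cong (×1-homo-* (suc m) (suc n))) (-‿distribˡ-* _ _)
  fromℤ-homo-* -[1+ m ]    -[1+ n ]   = trans (×1-homo-* (suc m) (suc n)) (sym (-x*-y≈x*y _ _))

  fromℤ-homo-neg : ∀ i → fromℤ (ℤ.- i) ≈ - fromℤ i
  fromℤ-homo-neg (+ zero)  = sym -0#≈0#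
  fromℤ-homo-neg (+ suc n) = refl
  fromℤ-homo-neg -[1+ n ]  = sym (-‿involutive _)

  private
    almostCommutativeRing : AlmostCommutativeRing c ℓ
    almostCommutativeRing = fromCommutativeRing R

    fromℤ-morphism : CommutativeRing.rawRing ℤ.+-*-commutativeRing -Raw-AlmostCommutative⟶ almostCommutativeRing
    fromℤ-morphism = record
      { ⟦_⟧ = fromℤ ; +-homo = fromℤ-homo-+ ; *-homo = fromℤ-homo-* ; -‿homo = fromℤ-homo-neg
      ; 0-homo = refl ; 1-homo = refl }

    _≟ℤ_ : ∀ i j → Maybe (fromℤ i ≈ fromℤ j)
    i ≟ℤ j with i ℤ.≟ j
    ... | yes ≡-refl = just refl
    ... | no _       = nothing

  open import Algebra.Solver.Ring _ almostCommutativeRing fromℤ-morphism _≟ℤ_ public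


module _ {c ℓ : Level} (R : CommutativeRing c ℓ) where
  open CommutativeRing R
  open import Algebra.Properties.Ring ring using (-‿distribˡ-*; -‿distribʳ-*; -‿+-comm; -‿involutive; -0#≈0#)
  import Algebra.Properties.Semiring.Mult semiring as ×ₚ
  open import Relation.Binary.Reasoning.Setoid setoid
  open ℤ-Solver R using (solve; _:=_; _:+_; _:*_; _:-_; :-_; con)
  import Data.Integer.Base as ℤ

  open import Data.Bool.Base using (true; false; if_then_else_; T)
  open import Data.Empty using (⊥-elim)
  open import Data.Fin.Base using (Fin; toℕ; punchIn; inject₁; fromℕ; lift; _<_)
    renaming (zero to fzero; suc to fsuc)
  import Data.Fin.Properties as Fin
  open import Data.Nat.Base as ℕ using (ℕ; zero; suc; s≤s; z≤n; _∸_; _<ᵇ_)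
  import Data.Nat.Properties as ℕ
  open import Data.Nat.Combinatorics using (_C_; k>n⇒nCk≡0)
  open import Data.Nat.DivMod using (_/_; m/n≤m)
  open import Data.Sum.Base using (inj₁; inj₂)
  open import Data.Vec.Functional using (Vector; updateAt)
  open import Data.Vec.Functional.Properties
    using (updateAt-updates; updateAt-minimal; updateAt-commutes; updateAt-id-local)
  open import Data.Vec.Functional.Relation.Binary.Pointwise using (Pointwise)
  open import Function.Base using (_∘_; _$_; const)
  open import Relation.Binary.Definitions using (tri<; tri≈; tri>)
  open import Relation.Binary.PropositionalEquality using (_≡_; _≢_; _≗_; cong; subst)
    renaming (refl to ≡-refl; sym to ≡-sym; trans to ≡-trans)
  open import Relation.Nullary.Decidable using (yes; no)

  infix 4 _≋_
  _≋_ : ∀ {n} → Vector Carrier n → Vector Carrier n → Set ℓ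
  _≋_ = Pointwise _≈_

  sumFin-cong : ∀ n {f g : Vector Carrier n} → f ≋ g → sumFin R n f ≈ sumFin R n g
  sumFin-cong zero    f≋g = refl
  sumFin-cong (suc n) f≋g = +-cong (f≋g fzero) (sumFin-cong n (λ j → f≋g (fsuc j)))

  sumFin-zero : ∀ n {f : Vector Carrier n} → (∀ j → f j ≈ 0#) → sumFin R n f ≈ 0#
  sumFin-zero zero    f≈0 = refl
  sumFin-zero (suc n) f≈0 = trans (+-cong (f≈0 fzero) (sumFin-zero n (λ j → f≈0 (fsuc j)))) (+-identityʳ 0#)

  sumFin-+ : ∀ n (f g : Vector Carrier n) → sumFin R n (λ j → f j + g j) ≈ sumFin R n f + sumFin R n g
  sumFin-+ zero    f g = sym (+-identityʳ 0#)
  sumFin-+ (suc n) f g = trans (+-congˡ (sumFin-+ n (λ j → f (fsuc j)) (λ j → g (fsuc j))))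
    (solve 4 (λ a b c d → (a :+ b) :+ (c :+ d) := (a :+ c) :+ (b :+ d)) refl _ _ _ _)

  sumFin-*ˡ : ∀ n x (f : Vector Carrier n) → sumFin R n (λ j → x * f j) ≈ x * sumFin R n f
  sumFin-*ˡ zero    x f = sym (zeroʳ x)
  sumFin-*ˡ (suc n) x f = trans (+-congˡ (sumFin-*ˡ n x (λ j → f (fsuc j)))) (sym (distribˡ x _ _))

  sumFin-neg : ∀ n (f : Vector Carrier n) → sumFin R n (λ j → - f j) ≈ - sumFin R n f
  sumFin-neg zero    f = sym -0#≈0#
  sumFin-neg (suc n) f = trans (+-congˡ (sumFin-neg n (λ j → f (fsuc j)))) (-‿+-comm _ _)

  sumFin-linear : ∀ n x {f g h : Vector Carrier n} → (∀ j → f j ≈ x * g j + h j) →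
                  sumFin R n f ≈ x * sumFin R n g + sumFin R n h
  sumFin-linear n x {f} {g} {h} f≈ = begin
    sumFin R n f                                   ≈⟨ sumFin-cong n f≈ ⟩
    sumFin R n (λ j → x * g j + h j)               ≈⟨ sumFin-+ n (λ j → x * g j) h ⟩
    sumFin R n (λ j → x * g j) + sumFin R n h      ≈⟨ +-congʳ (sumFin-*ˡ n x g) ⟩
    x * sumFin R n g + sumFin R n h                ∎

  sumFin-last : ∀ n (f : Vector Carrier (suc n)) → sumFin R (suc n) f ≈ sumFin R n (λ j → f (inject₁ j)) + f (fromℕ n)
  sumFin-last zero    f = trans (+-identityʳ _) (sym (+-identityˡ _))
  sumFin-last (suc n) f = trans (+-congˡ (sumFin-last n (λ j → f (fsuc j)))) (sym (+-assoc _ _ _))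

  sumFin-single : ∀ n {f : Vector Carrier n} r → (∀ t → t ≢ r → f t ≈ 0#) → sumFin R n f ≈ f r
  sumFin-single (suc n) fzero    f≈0 = trans (+-congˡ (sumFin-zero n (λ t → f≈0 (fsuc t) (λ ())))) (+-identityʳ _)
  sumFin-single (suc n) (fsuc r) f≈0 =
    trans (+-cong (f≈0 fzero (λ ())) (sumFin-single n r (λ t t≢r → f≈0 (fsuc t) (t≢r ∘ Fin.suc-injective))))
          (+-identityˡ _)

  Matrix : ℕ → Set c
  Matrix n = Vector (Vector Carrier n) n

  minor : ∀ {n} → Matrix (suc n) → Fin (suc n) → Matrix n
  minor M j r c = M (fsuc r) (punchIn j c)

  laplaceTerm : ∀ {n} → Matrix (suc n) → Fin (suc n) → Carrier
  laplaceTerm {n} M j = (sign R (toℕ j) * M fzero j) * det R n (minor M j)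

  det-cong : ∀ n {M N : Matrix n} → (∀ i → M i ≋ N i) → det R n M ≈ det R n N
  det-cong zero    M≋N = refl
  det-cong (suc n) {M} {N} M≋N = sumFin-cong (suc n) {laplaceTerm M} {laplaceTerm N} λ j →
    *-cong (*-congˡ (M≋N fzero j)) (det-cong n (λ r c → M≋N (fsuc r) (punchIn j c)))

  det-linear : ∀ n {M M₁ M₂ : Matrix n} r x →
               (∀ i → i ≢ r → M₁ i ≋ M i) → (∀ i → i ≢ r → M₂ i ≋ M i) →
               (∀ j → M r j ≈ x * M₁ r j + M₂ r j) →
               det R n M ≈ x * det R n M₁ + det R n M₂
  det-linear (suc n) {M} {M₁} {M₂} fzero x M₁≋M M₂≋M M₀≈ =
    sumFin-linear (suc n) x {laplaceTerm M} {laplaceTerm M₁} {laplaceTerm M₂} term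
    where
    term : ∀ j → laplaceTerm M j ≈ x * laplaceTerm M₁ j + laplaceTerm M₂ j
    term j = begin
      (s * M fzero j) * D                                 ≈⟨ *-congʳ (*-congˡ (M₀≈ j)) ⟩
      (s * (x * M₁ fzero j + M₂ fzero j)) * D
        ≈⟨ solve 5 (λ s x a b D → (s :* (x :* a :+ b)) :* D := x :* ((s :* a) :* D) :+ (s :* b) :* D) refl _ _ _ _ _ ⟩
      x * ((s * M₁ fzero j) * D) + (s * M₂ fzero j) * D
        ≈⟨ +-cong (*-congˡ (*-congˡ (sameMinor M₁≋M))) (*-congˡ (sameMinor M₂≋M)) ⟩
      x * laplaceTerm M₁ j + laplaceTerm M₂ j             ∎
      where
      s = sign R (toℕ j)
      D = det R n (minor M j)
      sameMinor : ∀ {N : Matrix (suc n)} → (∀ i → i ≢ fzero → N i ≋ M i) → D ≈ det R n (minor N j)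
      sameMinor N≋M = det-cong n λ r c → sym (N≋M (fsuc r) (λ ()) (punchIn j c))
  det-linear (suc n) {M} {M₁} {M₂} (fsuc r) x M₁≋M M₂≋M Mr≈ =
    sumFin-linear (suc n) x {laplaceTerm M} {laplaceTerm M₁} {laplaceTerm M₂} term
    where
    term : ∀ j → laplaceTerm M j ≈ x * laplaceTerm M₁ j + laplaceTerm M₂ j
    term j = begin
      e * det R n (minor M j)
        ≈⟨ *-congˡ (det-linear n r x (minorAgrees M₁≋M) (minorAgrees M₂≋M) (Mr≈ ∘ punchIn j)) ⟩
      e * (x * det R n (minor M₁ j) + det R n (minor M₂ j))
        ≈⟨ solve 4 (λ a x D₁ D₂ → a :* (x :* D₁ :+ D₂) := x :* (a :* D₁) :+ a :* D₂) refl _ _ _ _ ⟩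
      x * (e * det R n (minor M₁ j)) + e * det R n (minor M₂ j)
        ≈⟨ +-cong (*-congˡ (*-congʳ (sameEntry M₁≋M))) (*-congʳ (sameEntry M₂≋M)) ⟩
      x * laplaceTerm M₁ j + laplaceTerm M₂ j             ∎
      where
      e = sign R (toℕ j) * M fzero j
      sameEntry : ∀ {N : Matrix (suc n)} → (∀ i → i ≢ fsuc r → N i ≋ M i) → e ≈ sign R (toℕ j) * N fzero j
      sameEntry N≋M = *-congˡ (sym (N≋M fzero (λ ()) j))
      minorAgrees : ∀ {N : Matrix (suc n)} → (∀ i → i ≢ fsuc r → N i ≋ M i) →
                    ∀ i → i ≢ r → minor N j i ≋ minor M j i
      minorAgrees N≋M i i≢r c = N≋M (fsuc i) (i≢r ∘ Fin.suc-injective) (punchIn j c)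

  det-zeroRow : ∀ n {M : Matrix n} r → (∀ c → M r c ≈ 0#) → det R n M ≈ 0#
  det-zeroRow (suc n) {M} fzero    M₀≈0 = sumFin-zero (suc n) {laplaceTerm M} λ j →
    trans (*-congʳ (trans (*-congˡ (M₀≈0 j)) (zeroʳ _))) (zeroˡ _)
  det-zeroRow (suc n) {M} (fsuc r) Mr≈0 = sumFin-zero (suc n) {laplaceTerm M} λ j →
    trans (*-congˡ (det-zeroRow n r (λ c → Mr≈0 (punchIn j c)))) (zeroʳ _)

  infixl 6 _[_]≔_
  _[_]≔_ : ∀ {n} → Matrix n → Fin n → Vector Carrier n → Matrix n
  M [ r ]≔ w = updateAt M r (const w)

  ≡⇒≋ : ∀ {n} {u v : Vector Carrier n} → u ≡ v → u ≋ v
  ≡⇒≋ ≡-refl _ = refl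

  Extensional : ∀ {m k} → ((Fin m → Fin k) → Carrier) → Set ℓ
  Extensional g = ∀ {e e′} → e ≗ e′ → g e ≈ g e′

  -- The Laplace expansion along two rows u and v, where g e stands for the determinant of the
  -- remaining rows restricted to the columns e.
  twoRowExpansion : ∀ m → (u v : Vector Carrier (suc (suc m))) → ((Fin m → Fin (suc (suc m))) → Carrier) → Carrier
  twoRowExpansion m u v g = sumFin R (suc (suc m)) λ j → (sign R (toℕ j) * u j) *
    sumFin R (suc m) λ l → (sign R (toℕ l) * v (punchIn j l)) * g (punchIn j ∘ punchIn l)

  shiftedExpansion : ∀ m → Vector Carrier (suc (suc m)) → ((Fin (suc m) → Fin (suc (suc (suc m)))) → Carrier) → Carrier
  shiftedExpansion m w g = sumFin R (suc (suc m)) λ l → (sign R (toℕ l) * w l) * g (fsuc ∘ punchIn l)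

  -- Split off the terms in which one of the two rows uses the first column.
  twoRowExpansion-suc : ∀ m u v g → Extensional g →
    twoRowExpansion (suc m) u v g ≈
      (1# * u fzero) * shiftedExpansion m (v ∘ fsuc) g
      + (- (v fzero * shiftedExpansion m (u ∘ fsuc) g) + twoRowExpansion m (u ∘ fsuc) (v ∘ fsuc) (g ∘ lift 1))
  twoRowExpansion-suc m u v g g-ext = +-congˡ (begin
    sumFin R (suc (suc m)) F                                        ≈⟨ sumFin-cong (suc (suc m)) {F} split ⟩
    sumFin R (suc (suc m)) (λ j → - (v fzero * X j) + Y j)          ≈⟨ sumFin-+ (suc (suc m)) (λ j → - (v fzero * X j)) Y ⟩
    sumFin R (suc (suc m)) (λ j → - (v fzero * X j)) + sumFin R (suc (suc m)) Y
      ≈⟨ +-congʳ (trans (sumFin-neg (suc (suc m)) (λ j → v fzero * X j)) (-‿cong (sumFin-*ˡ (suc (suc m)) (v fzero) X))) ⟩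
    - (v fzero * shiftedExpansion m (u ∘ fsuc) g) + twoRowExpansion m (u ∘ fsuc) (v ∘ fsuc) (g ∘ lift 1) ∎)
    where
    s : ∀ {n} → Fin n → Carrier
    s j = sign R (toℕ j)
    G : Fin (suc (suc m)) → Fin (suc m) → Carrier
    G j l = g (lift 1 (punchIn j ∘ punchIn l))
    Term : Fin (suc (suc m)) → Fin (suc m) → Carrier
    Term j l = (s l * v (fsuc (punchIn j l))) * G j l
    I : Fin (suc (suc m)) → Carrier
    I j = sumFin R (suc m) (Term j)
    F X Y : Fin (suc (suc m)) → Carrier
    F j = (s (fsuc j) * u (fsuc j)) *
      sumFin R (suc (suc m)) (λ l → (s l * v (punchIn (fsuc j) l)) * g (punchIn (fsuc j) ∘ punchIn l))
    X j = (s j * u (fsuc j)) * g (fsuc ∘ punchIn j)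
    Y j = (s j * u (fsuc j)) * I j
    inner : ∀ j → sumFin R (suc m) (λ l → (s (fsuc l) * v (fsuc (punchIn j l))) * g (punchIn (fsuc j) ∘ punchIn (fsuc l)))
                  ≈ - I j
    inner j = trans (sumFin-cong (suc m) {g = λ l → - Term j l} λ l →
                      trans (*-cong (sym (-‿distribˡ-* _ _))
                                    (g-ext {punchIn (fsuc j) ∘ punchIn (fsuc l)} {lift 1 (punchIn j ∘ punchIn l)}
                                           λ { fzero → ≡-refl ; (fsuc c) → ≡-refl }))
                            (sym (-‿distribˡ-* _ _)))
                    (sumFin-neg (suc m) (Term j))
    split : ∀ j → F j ≈ - (v fzero * X j) + Y j
    split j = begin
      F j                                                                   ≈⟨ *-congˡ (+-congˡ (inner j)) ⟩
      (- s j * u (fsuc j)) * ((1# * v fzero) * g (fsuc ∘ punchIn j) + - I j)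
        ≈⟨ solve 5 (λ s u v G I → (:- s :* u) :* ((con (ℤ.+ 1) :* v) :* G :+ :- I)
                                  := :- (v :* ((s :* u) :* G)) :+ (s :* u) :* I) refl _ _ _ _ _ ⟩
      - (v fzero * X j) + Y j                                               ∎

  twoRowExpansion-equalRows : ∀ m {u v g} → u ≋ v → Extensional g → twoRowExpansion m u v g ≈ 0#
  twoRowExpansion-equalRows zero {u} {v} {g} u≋v g-ext = begin
    (1# * u fzero) * ((1# * v (fsuc fzero)) * g _ + 0#) + ((- 1# * u (fsuc fzero)) * ((1# * v fzero) * g _ + 0#) + 0#)
      ≈⟨ +-congˡ (+-congʳ (*-cong (*-congˡ (u≋v (fsuc fzero))) (+-congʳ (*-cong (*-congˡ (sym (u≋v fzero))) (g-ext λ ()))))) ⟩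
    (1# * u fzero) * ((1# * v (fsuc fzero)) * g _ + 0#) + ((- 1# * v (fsuc fzero)) * ((1# * u fzero) * g _ + 0#) + 0#)
      ≈⟨ solve 3 (λ a b G → (one :* a) :* ((one :* b) :* G :+ zero′)
                            :+ ((:- one :* b) :* ((one :* a) :* G :+ zero′) :+ zero′) := zero′) refl _ _ _ ⟩
    0# ∎
    where one = con (ℤ.+ 1); zero′ = con (ℤ.+ 0)
  twoRowExpansion-equalRows (suc m) {u} {v} {g} u≋v g-ext = begin
    twoRowExpansion (suc m) u v g                                    ≈⟨ twoRowExpansion-suc m u v g g-ext ⟩
    (1# * u fzero) * shiftedExpansion m (v ∘ fsuc) g + (- (v fzero * shiftedExpansion m (u ∘ fsuc) g) + _)
      ≈⟨ +-cong (*-cong (*-congˡ (u≋v fzero))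
                        (sumFin-cong (suc (suc m)) {g = Term u} λ l → *-congʳ (*-congˡ (sym (u≋v (fsuc l))))))
                (+-congˡ (twoRowExpansion-equalRows m (u≋v ∘ fsuc) lift-ext)) ⟩
    (1# * v fzero) * A + (- (v fzero * A) + 0#)
      ≈⟨ solve 2 (λ a b → (con (ℤ.+ 1) :* a) :* b :+ (:- (a :* b) :+ con (ℤ.+ 0)) := con (ℤ.+ 0)) refl _ _ ⟩
    0# ∎
    where
    A = shiftedExpansion m (u ∘ fsuc) g
    Term : Vector Carrier (suc (suc (suc m))) → Fin (suc (suc m)) → Carrier
    Term w l = (sign R (toℕ l) * w (fsuc l)) * g (fsuc ∘ punchIn l)
    lift-ext : Extensional (g ∘ lift 1)
    lift-ext {e} {e′} e≗e′ = g-ext {lift 1 e} {lift 1 e′} λ { fzero → ≡-refl ; (fsuc c) → cong fsuc (e≗e′ c) }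

  det-firstRowsEqual : ∀ m {M : Matrix (suc (suc m))} → M fzero ≋ M (fsuc fzero) → det R (suc (suc m)) M ≈ 0#
  det-firstRowsEqual m {M} M₀≋M₁ = twoRowExpansion-equalRows m M₀≋M₁
    λ e≗e′ → det-cong m λ r c → reflexive (cong (M (fsuc (fsuc r))) (e≗e′ c))

  Alternating : ℕ → Set (c ⊔ ℓ)
  Alternating n = ∀ {M : Matrix n} {i j} → i < j → M i ≋ M j → det R n M ≈ 0#

  record RowSwap {n} (M M′ : Matrix n) (i j : Fin n) : Set ℓ where
    field
      at-i   : M′ i ≋ M j
      at-j   : M′ j ≋ M i
      others : ∀ k → k ≢ i → k ≢ j → M′ k ≋ M k

  replaceRows : ∀ {n} → Matrix n → Fin n → Fin n → Vector Carrier n → Vector Carrier n → Matrix n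
  replaceRows M i j u w = M [ i ]≔ u [ j ]≔ w

  module _ {n} (M : Matrix n) {i j : Fin n} (i≢j : i ≢ j) {u w : Vector Carrier n} where

    replaceRows-i : replaceRows M i j u w i ≡ u
    replaceRows-i = ≡-trans (updateAt-minimal i j _ i≢j) (updateAt-updates i M)

    replaceRows-j : replaceRows M i j u w j ≡ w
    replaceRows-j = updateAt-updates j _

    replaceRows-other : ∀ k → k ≢ i → k ≢ j → replaceRows M i j u w k ≡ M k
    replaceRows-other k k≢i k≢j = ≡-trans (updateAt-minimal k j _ k≢j) (updateAt-minimal k i M k≢i)

    replaceRows-≋ : ∀ {N : Matrix n} → N i ≋ u → N j ≋ w → (∀ k → k ≢ i → k ≢ j → N k ≋ M k) →
                    ∀ k → replaceRows M i j u w k ≋ N k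
    replaceRows-≋ Ni≋u Nj≋w others k with k Fin.≟ i | k Fin.≟ j
    ... | yes ≡-refl | _          = λ c → trans (≡⇒≋ replaceRows-i c) (sym (Ni≋u c))
    ... | no _       | yes ≡-refl = λ c → trans (≡⇒≋ replaceRows-j c) (sym (Nj≋w c))
    ... | no k≢i     | no k≢j     = λ c → trans (≡⇒≋ (replaceRows-other k k≢i k≢j) c) (sym (others k k≢i k≢j c))

  swapRows : ∀ {n} → Matrix n → Fin n → Fin n → Matrix n
  swapRows M i j = replaceRows M i j (M j) (M i)

  swapRows-rowSwap : ∀ {n} (M : Matrix n) {i j} → i ≢ j → RowSwap M (swapRows M i j) i j
  swapRows-rowSwap M i≢j = record
    { at-i   = ≡⇒≋ (replaceRows-i M i≢j)
    ; at-j   = ≡⇒≋ (replaceRows-j M i≢j)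
    ; others = λ k k≢i k≢j → ≡⇒≋ (replaceRows-other M i≢j k k≢i k≢j) }

  RowSwap-minor : ∀ {n} {M M′ : Matrix (suc n)} {i j} → RowSwap M M′ (fsuc i) (fsuc j) →
                  ∀ c → RowSwap (minor M c) (minor M′ c) i j
  RowSwap-minor swap c = record
    { at-i   = λ c′ → at-i (punchIn c c′)
    ; at-j   = λ c′ → at-j (punchIn c c′)
    ; others = λ k k≢i k≢j c′ → others (fsuc k) (k≢i ∘ Fin.suc-injective) (k≢j ∘ Fin.suc-injective) (punchIn c c′) }
    where open RowSwap swap

  det-replaceRow-linear : ∀ n (M : Matrix n) r x {w u v : Vector Carrier n} → (∀ c → w c ≈ x * u c + v c) →
    det R n (M [ r ]≔ w) ≈ x * det R n (M [ r ]≔ u) + det R n (M [ r ]≔ v)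
  det-replaceRow-linear n M r x w≈ = det-linear n r x (λ i i≢r → ≡⇒≋ (off i i≢r)) (λ i i≢r → ≡⇒≋ (off i i≢r))
    λ c → trans (≡⇒≋ (updateAt-updates r M) c)
                (trans (w≈ c) (sym (+-cong (*-congˡ (≡⇒≋ (updateAt-updates r M) c)) (≡⇒≋ (updateAt-updates r M) c))))
    where
    off : ∀ {w w′} i → i ≢ r → (M [ r ]≔ w) i ≡ (M [ r ]≔ w′) i
    off i i≢r = ≡-trans (updateAt-minimal i r M i≢r) (≡-sym (updateAt-minimal i r M i≢r))

  det-replaceRow-sum : ∀ n (M : Matrix n) r m (q : Vector Carrier m) (W : Vector (Vector Carrier n) m) →
    det R n (M [ r ]≔ (λ c → sumFin R m (λ t → q t * W t c))) ≈ sumFin R m (λ t → q t * det R n (M [ r ]≔ W t))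
  det-replaceRow-sum n M r zero    q W = det-zeroRow n r (≡⇒≋ (updateAt-updates r M))
  det-replaceRow-sum n M r (suc m) q W = trans
    (det-replaceRow-linear n M r (q fzero) {u = W fzero} {v = λ c → sumFin R m (λ t → q (fsuc t) * W (fsuc t) c)} λ _ → refl)
    (+-congˡ (det-replaceRow-sum n M r m (λ t → q (fsuc t)) (λ t → W (fsuc t))))

  det-replaceRow-+ : ∀ n (M : Matrix n) r (u v : Vector Carrier n) →
    det R n (M [ r ]≔ (λ c → u c + v c)) ≈ det R n (M [ r ]≔ u) + det R n (M [ r ]≔ v)
  det-replaceRow-+ n M r u v =
    trans (det-replaceRow-linear n M r 1# λ c → +-congʳ (sym (*-identityˡ (u c)))) (+-congʳ (*-identityˡ _))

  -- With s = Mᵢ + Mⱼ, additivity in rows i and j expands 0 ≈ det (B s s) into det M + det M′.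
  det-swap : ∀ n → Alternating n → ∀ {M M′ : Matrix n} {i j} → i < j → RowSwap M M′ i j →
             det R n M′ ≈ - det R n M
  det-swap n alt {M} {M′} {i} {j} i<j swap = begin
    det R n M′
      ≈⟨ solve 2 (λ D D′ → D′ := ((o :+ D) :+ (D′ :+ o)) :- D) refl _ _ ⟩
    ((0# + det R n M) + (det R n M′ + 0#)) - det R n M           ≈⟨ +-congʳ expand ⟨
    det R n (B s s) - det R n M                                   ≈⟨ +-congʳ (B-alternating s) ⟩
    0# - det R n M                                                ≈⟨ +-identityˡ _ ⟩
    - det R n M                                                   ∎
    where
    o = con (ℤ.+ 0)
    i≢j = Fin.<⇒≢ i<j
    B = replaceRows M i j
    s : Vector Carrier n
    s c = M i c + M j c
    open RowSwap swap
    B-alternating : ∀ u → det R n (B u u) ≈ 0#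
    B-alternating u = alt i<j λ c → trans (≡⇒≋ (replaceRows-i M i≢j) c) (sym (≡⇒≋ (replaceRows-j M i≢j) c))
    additiveʳ : ∀ u w₁ w₂ → det R n (B u (λ c → w₁ c + w₂ c)) ≈ det R n (B u w₁) + det R n (B u w₂)
    additiveʳ u = det-replaceRow-+ n (M [ i ]≔ u) j
    additiveˡ : ∀ u₁ u₂ w → det R n (B (λ c → u₁ c + u₂ c) w) ≈ det R n (B u₁ w) + det R n (B u₂ w)
    additiveˡ u₁ u₂ w = begin
      det R n (B (λ c → u₁ c + u₂ c) w)                           ≈⟨ commute _ ⟩
      det R n (M [ j ]≔ w [ i ]≔ (λ c → u₁ c + u₂ c))             ≈⟨ det-replaceRow-+ n (M [ j ]≔ w) i u₁ u₂ ⟩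
      det R n (M [ j ]≔ w [ i ]≔ u₁) + det R n (M [ j ]≔ w [ i ]≔ u₂) ≈⟨ +-cong (commute u₁) (commute u₂) ⟨
      det R n (B u₁ w) + det R n (B u₂ w)                         ∎
      where
      commute : ∀ u → det R n (B u w) ≈ det R n (M [ j ]≔ w [ i ]≔ u)
      commute u = det-cong n λ k → ≡⇒≋ (≡-sym (updateAt-commutes i j i≢j M k))
    expand : det R n (B s s) ≈ (0# + det R n M) + (det R n M′ + 0#)
    expand = begin
      det R n (B s s)                                             ≈⟨ additiveˡ (M i) (M j) s ⟩
      det R n (B (M i) s) + det R n (B (M j) s)
        ≈⟨ +-cong (additiveʳ (M i) (M i) (M j)) (additiveʳ (M j) (M i) (M j)) ⟩
      (det R n (B (M i) (M i)) + det R n (B (M i) (M j))) + (det R n (B (M j) (M i)) + det R n (B (M j) (M j)))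
        ≈⟨ +-cong (+-cong (B-alternating (M i))
                          (det-cong n (replaceRows-≋ M i≢j {N = M} (λ _ → refl) (λ _ → refl) (λ _ _ _ _ → refl))))
                  (+-cong (det-cong n (replaceRows-≋ M i≢j {N = M′} at-i at-j others)) (B-alternating (M j))) ⟩
      (0# + det R n M) + (det R n M′ + 0#)                        ∎

  -- Exchanging rows 1 and j + 2 negates each minor and puts the repeated row next to row 0.
  det-firstRowRepeated : ∀ m → Alternating (suc m) → ∀ {M : Matrix (suc (suc m))} j →
                              M fzero ≋ M (fsuc (fsuc j)) → det R (suc (suc m)) M ≈ 0#
  det-firstRowRepeated m alt {M} j M₀≋Mj = begin
    det R (suc (suc m)) M                 ≈⟨ -‿involutive _ ⟨
    - - det R (suc (suc m)) M             ≈⟨ -‿cong M′-negates ⟨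
    - det R (suc (suc m)) M′
      ≈⟨ -‿cong (det-firstRowsEqual m {M′} λ c → trans (≡⇒≋ M′₀ c) (trans (M₀≋Mj c) (sym (≡⇒≋ M′₁ c)))) ⟩
    - 0#                                  ≈⟨ -0#≈0# ⟩
    0#                                    ∎
    where
    1≢j : fsuc fzero ≢ fsuc (fsuc j)
    1≢j ()
    M′ = swapRows M (fsuc fzero) (fsuc (fsuc j))
    M′₀ : M′ fzero ≡ M fzero
    M′₀ = replaceRows-other M 1≢j {M (fsuc (fsuc j))} {M (fsuc fzero)} fzero (λ ()) (λ ())
    M′₁ : M′ (fsuc fzero) ≡ M (fsuc (fsuc j))
    M′₁ = replaceRows-i M 1≢j {M (fsuc (fsuc j))} {M (fsuc fzero)}
    M′-negates : det R (suc (suc m)) M′ ≈ - det R (suc (suc m)) M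
    M′-negates = trans (sumFin-cong (suc (suc m)) {laplaceTerm M′} {λ c → - laplaceTerm M c} λ c →
                          trans (*-cong (*-congˡ (≡⇒≋ M′₀ c))
                                        (det-swap (suc m) alt (s≤s z≤n)
                                                  (RowSwap-minor (swapRows-rowSwap M 1≢j) c)))
                                (sym (-‿distribʳ-* _ _)))
                       (sumFin-neg (suc (suc m)) (laplaceTerm M))

  det-alternating : ∀ n → Alternating n
  det-alternating (suc n) {M} {fsuc i} {fsuc j} i+1<j+1 Mi≋Mj = sumFin-zero (suc n) {laplaceTerm M} λ c →
    trans (*-congˡ (det-alternating n (ℕ.s<s⁻¹ i+1<j+1) λ c′ → Mi≋Mj (punchIn c c′))) (zeroʳ _)
  det-alternating (suc (suc m)) {M} {fzero} {fsuc fzero} _ M₀≋M₁ = det-firstRowsEqual m {M} M₀≋M₁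
  det-alternating (suc (suc m)) {M} {fzero} {fsuc (fsuc j)} _ = det-firstRowRepeated m (det-alternating (suc m)) {M} j

  det-equalRows : ∀ n {M : Matrix n} {i j} → i ≢ j → M i ≋ M j → det R n M ≈ 0#
  det-equalRows n {i = i} {j} i≢j Mi≋Mj with Fin.<-cmp i j
  ... | tri< i<j _ _ = det-alternating n i<j Mi≋Mj
  ... | tri≈ _ i≡j _ = ⊥-elim (i≢j i≡j)
  ... | tri> _ _ j<i = det-alternating n j<i (λ c → sym (Mi≋Mj c))

  det-replaceRow-combination : ∀ n (M : Matrix n) r (p : Vector Carrier n) →
    det R n (M [ r ]≔ (λ c → sumFin R n (λ t → p t * M t c))) ≈ p r * det R n M
  det-replaceRow-combination n M r p = begin
    det R n (M [ r ]≔ (λ c → sumFin R n (λ t → p t * M t c)))    ≈⟨ det-replaceRow-sum n M r n p M ⟩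
    sumFin R n (λ t → p t * det R n (M [ r ]≔ M t))              ≈⟨ sumFin-single n r vanish ⟩
    p r * det R n (M [ r ]≔ M r)                                 ≈⟨ *-congˡ (det-cong n λ k → ≡⇒≋ (updateAt-id-local r M ≡-refl k)) ⟩
    p r * det R n M                                              ∎
    where
    vanish : ∀ t → t ≢ r → p t * det R n (M [ r ]≔ M t) ≈ 0#
    vanish t t≢r = trans (*-congˡ (det-equalRows n t≢r λ c →
                     trans (≡⇒≋ (updateAt-minimal t r M t≢r) c) (sym (≡⇒≋ (updateAt-updates r M) c))))
                   (zeroʳ _)

  det-lastRow : ∀ n (M : Matrix (suc n)) → (∀ c → M (fromℕ n) (inject₁ c) ≈ 0#) →
    det R (suc n) M ≈ M (fromℕ n) (fromℕ n) * det R n (λ i j → M (inject₁ i) (inject₁ j))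
  det-lastRow zero    M _         = trans (+-identityʳ _) (*-congʳ (*-identityˡ _))
  det-lastRow (suc n) M lastRow≈0 = begin
    sumFin R (suc (suc n)) (laplaceTerm M)                              ≈⟨ sumFin-last (suc n) (laplaceTerm M) ⟩
    sumFin R (suc n) (λ c → laplaceTerm M (inject₁ c)) + laplaceTerm M L
      ≈⟨ +-cong (sumFin-cong (suc n) {g = λ c → d * laplaceTerm UL c} inner) lastTerm≈0 ⟩
    sumFin R (suc n) (λ c → d * laplaceTerm UL c) + 0#                  ≈⟨ +-identityʳ _ ⟩
    sumFin R (suc n) (λ c → d * laplaceTerm UL c)                       ≈⟨ sumFin-*ˡ (suc n) d (laplaceTerm UL) ⟩
    d * det R (suc n) UL                                                ∎
    where
    L = fromℕ (suc n)
    d = M L L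
    UL : Matrix (suc n)
    UL i j = M (inject₁ i) (inject₁ j)
    lastTerm≈0 : laplaceTerm M L ≈ 0#
    lastTerm≈0 = trans (*-congˡ (det-zeroRow (suc n) {minor M L} (fromℕ n) λ c →
                   trans (reflexive (cong (M L) (punchIn-fromℕ (suc n) c))) (lastRow≈0 c))) (zeroʳ _)
    inner : ∀ c → laplaceTerm M (inject₁ c) ≈ d * laplaceTerm UL c
    inner c = begin
      (sign R (toℕ (inject₁ c)) * M fzero (inject₁ c)) * det R (suc n) (minor M (inject₁ c))
        ≈⟨ *-cong (*-congʳ (reflexive (cong (sign R) (Fin.toℕ-inject₁ c))))
                  (det-lastRow n (minor M (inject₁ c)) λ c′ →
                    trans (reflexive (cong (M L) (punchIn-inject₁ n c c′))) (lastRow≈0 _)) ⟩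
      (sign R (toℕ c) * UL fzero c) *
        (M L (punchIn (inject₁ c) (fromℕ n)) * det R n (λ i j → M (fsuc (inject₁ i)) (punchIn (inject₁ c) (inject₁ j))))
        ≈⟨ *-congˡ (*-cong (reflexive (cong (M L) (punchIn-inject₁-fromℕ n c)))
                           (det-cong n λ i j → reflexive (cong (M (fsuc (inject₁ i))) (punchIn-inject₁ n c j)))) ⟩
      (sign R (toℕ c) * UL fzero c) * (d * det R n (minor UL c))
        ≈⟨ solve 3 (λ a d D → a :* (d :* D) := d :* (a :* D)) refl _ _ _ ⟩
      d * laplaceTerm UL c                                              ∎

  sumTo-cong : ∀ m {f g : ℕ → Carrier} → (∀ i → i ℕ.≤ m → f i ≈ g i) → sumTo R m f ≈ sumTo R m g
  sumTo-cong zero    f≈g = f≈g 0 z≤n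
  sumTo-cong (suc m) f≈g = +-cong (sumTo-cong m λ i i≤m → f≈g i (ℕ.m≤n⇒m≤1+n i≤m)) (f≈g (suc m) ℕ.≤-refl)

  sumTo-+ : ∀ m (f g : ℕ → Carrier) → sumTo R m (λ i → f i + g i) ≈ sumTo R m f + sumTo R m g
  sumTo-+ zero    f g = refl
  sumTo-+ (suc m) f g = trans (+-congʳ (sumTo-+ m f g))
    (solve 4 (λ a b c d → (a :+ b) :+ (c :+ d) := (a :+ c) :+ (b :+ d)) refl _ _ _ _)

  sumTo-*ˡ : ∀ m x (f : ℕ → Carrier) → sumTo R m (λ i → x * f i) ≈ x * sumTo R m f
  sumTo-*ˡ zero    x f = refl
  sumTo-*ˡ (suc m) x f = trans (+-congʳ (sumTo-*ˡ m x f)) (sym (distribˡ x _ _))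

  sumTo-neg : ∀ m (f : ℕ → Carrier) → sumTo R m (λ i → - f i) ≈ - sumTo R m f
  sumTo-neg zero    f = refl
  sumTo-neg (suc m) f = trans (+-congʳ (sumTo-neg m f)) (-‿+-comm _ _)

  sumTo-suc : ∀ m (f : ℕ → Carrier) → sumTo R (suc m) f ≈ f 0 + sumTo R m (λ i → f (suc i))
  sumTo-suc zero    f = refl
  sumTo-suc (suc m) f = trans (+-congʳ (sumTo-suc m f)) (+-assoc _ _ _)

  sumTo-dropLast : ∀ m {f : ℕ → Carrier} → f (suc m) ≈ 0# → sumTo R (suc m) f ≈ sumTo R m f
  sumTo-dropLast m last≈0 = trans (+-congˡ last≈0) (+-identityʳ _)

  sumTo-vanishingTail : ∀ m p {f : ℕ → Carrier} → p ℕ.≤ m → (∀ i → p ℕ.< i → i ℕ.≤ m → f i ≈ 0#) →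
                        sumTo R m f ≈ sumTo R p f
  sumTo-vanishingTail zero    p p≤0 _ rewrite ℕ.n≤0⇒n≡0 p≤0 = refl
  sumTo-vanishingTail (suc m) p p≤1+m f≈0 with ℕ.m≤n⇒m<n∨m≡n p≤1+m
  ... | inj₂ ≡-refl = refl
  ... | inj₁ (s≤s p≤m) = trans (sumTo-dropLast m (f≈0 (suc m) (s≤s p≤m) ℕ.≤-refl))
                               (sumTo-vanishingTail m p p≤m λ i p<i i≤m → f≈0 i p<i (ℕ.m≤n⇒m≤1+n i≤m))

  sumFin≈sumTo : ∀ n (f : ℕ → Carrier) → sumFin R (suc n) (λ t → f (toℕ t)) ≈ sumTo R n f
  sumFin≈sumTo zero    f = +-identityʳ _
  sumFin≈sumTo (suc n) f = trans (+-congˡ (sumFin≈sumTo n (λ i → f (suc i)))) (sym (sumTo-suc n f))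

  ×≡×ₚ : ∀ n x → _×_ R n x ≡ n ×ₚ.× x
  ×≡×ₚ zero    x = ≡-refl
  ×≡×ₚ (suc n) x = cong (x +_) (×≡×ₚ n x)

  ×-homo-+ : ∀ x m n → _×_ R (m ℕ.+ n) x ≈ _×_ R m x + _×_ R n x
  ×-homo-+ x m n rewrite ×≡×ₚ (m ℕ.+ n) x | ×≡×ₚ m x | ×≡×ₚ n x = ×ₚ.×-homo-+ x m n

  ×-comm-* : ∀ n x y → x * _×_ R n y ≈ _×_ R n (x * y)
  ×-comm-* n x y rewrite ×≡×ₚ n y | ×≡×ₚ n (x * y) = ×ₚ.×-comm-* n x y

  ×-congʳ : ∀ n {x y} → x ≈ y → _×_ R n x ≈ _×_ R n y
  ×-congʳ n {x} {y} x≈y rewrite ×≡×ₚ n x | ×≡×ₚ n y = ×ₚ.×-congʳ n x≈y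

  1^≈1 : ∀ k → _^_ R 1# k ≈ 1#
  1^≈1 zero    = refl
  1^≈1 (suc k) = trans (*-identityˡ _) (1^≈1 k)

  -- π n i is the coefficient of tⁱ in the n-th monic orthogonal polynomial πₙ(t) for the moments a:
  -- π₀ = 1, π₁ = t - 1 and πₙ₊₂ = t πₙ₊₁ - πₙ.
  π : ℕ → ℕ → Carrier
  π zero          zero          = 1#
  π zero          (suc i)       = 0#
  π (suc zero)    zero          = - 1#
  π (suc zero)    (suc zero)    = 1#
  π (suc zero)    (suc (suc i)) = 0#
  π (suc (suc n)) zero          = - π n 0
  π (suc (suc n)) (suc i)       = π (suc n) i - π n (suc i)

  π-above : ∀ n i → n ℕ.< i → π n i ≈ 0#
  π-above zero          (suc i)       _         = refl
  π-above (suc zero)    (suc zero)    (s≤s ())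
  π-above (suc zero)    (suc (suc i)) _         = refl
  π-above (suc (suc n)) (suc i)       (s≤s 1+n<i) =
    trans (+-cong (π-above (suc n) i 1+n<i) (-‿cong (π-above n (suc i) (ℕ.<-trans (ℕ.n<1+n n) (ℕ.m<n⇒m<1+n 1+n<i)))))
          (trans (+-congˡ -0#≈0#) (+-identityʳ 0#))

  π-leading : ∀ n → π n n ≈ 1#
  π-leading zero          = refl
  π-leading (suc zero)    = refl
  π-leading (suc (suc n)) =
    trans (+-cong (π-leading (suc n)) (-‿cong (π-above n (suc (suc n)) (ℕ.m<n⇒m<1+n (ℕ.n<1+n n)))))
          (trans (+-congˡ -0#≈0#) (+-identityʳ 1#))

  -- ℒπ n f is ℒ(πₙ) for the linear functional ℒ with moments ℒ(tⁱ) = f i.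
  ℒπ : ℕ → (ℕ → Carrier) → Carrier
  ℒπ n f = sumTo R n (λ i → π n i * f i)

  ℒπ-cong : ∀ n {f g : ℕ → Carrier} → (∀ i → f i ≈ g i) → ℒπ n f ≈ ℒπ n g
  ℒπ-cong n f≈g = sumTo-cong n λ i _ → *-congˡ (f≈g i)

  ℒπ-constantTerm : ∀ n f → ℒπ n f ≈ π n 0 * f 0 + sumTo R n (λ i → π n (suc i) * f (suc i))
  ℒπ-constantTerm zero    f = sym (trans (+-congˡ (zeroˡ _)) (+-identityʳ _))
  ℒπ-constantTerm (suc n) f = trans (sumTo-suc n (λ i → π (suc n) i * f i)) (+-congˡ (sym (sumTo-dropLast n top≈0)))
    where
    top≈0 : π (suc n) (suc (suc n)) * f (suc (suc n)) ≈ 0#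
    top≈0 = trans (*-congʳ (π-above (suc n) (suc (suc n)) (ℕ.n<1+n (suc n)))) (zeroˡ _)

  -- Multiplication by t shifts the moments.
  ℒπ-recurrence : ∀ n f → ℒπ (suc (suc n)) f ≈ ℒπ (suc n) (λ i → f (suc i)) - ℒπ n f
  ℒπ-recurrence n f = begin
    ℒπ (suc (suc n)) f                                          ≈⟨ sumTo-suc (suc n) (λ i → π (suc (suc n)) i * f i) ⟩
    - π n 0 * f 0 + sumTo R (suc n) (λ i → (π (suc n) i - π n (suc i)) * f (suc i))
      ≈⟨ +-congˡ (sumTo-cong (suc n) λ i _ → trans (distribʳ _ _ _) (+-congˡ (sym (-‿distribˡ-* _ _)))) ⟩
    - π n 0 * f 0 + sumTo R (suc n) (λ i → π (suc n) i * f (suc i) - π n (suc i) * f (suc i))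
      ≈⟨ +-congˡ (trans (sumTo-+ (suc n) _ _) (+-congˡ (sumTo-neg (suc n) (λ i → π n (suc i) * f (suc i))))) ⟩
    - π n 0 * f 0 + (ℒπ (suc n) (λ i → f (suc i)) - sumTo R (suc n) (λ i → π n (suc i) * f (suc i)))
      ≈⟨ +-congˡ (+-congˡ (-‿cong (sumTo-dropLast n
            (trans (*-congʳ (π-above n (suc (suc n)) (ℕ.m<n⇒m<1+n (ℕ.n<1+n n)))) (zeroˡ _))))) ⟩
    - π n 0 * f 0 + (ℒπ (suc n) (λ i → f (suc i)) - sumTo R n (λ i → π n (suc i) * f (suc i)))
      ≈⟨ solve 4 (λ p f₀ L S → (:- p) :* f₀ :+ (L :- S) := L :- (p :* f₀ :+ S)) refl _ _ _ _ ⟩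
    ℒπ (suc n) (λ i → f (suc i)) - (π n 0 * f 0 + sumTo R n (λ i → π n (suc i) * f (suc i)))
      ≈⟨ +-congˡ (-‿cong (ℒπ-constantTerm n f)) ⟨
    ℒπ (suc n) (λ i → f (suc i)) - ℒπ n f                      ∎

  a≈paths : ∀ m → a R m ≈ _×_ R (paths m 0) 1#
  a≈paths m = reflexive (cong (λ k → _×_ R k 1#) (≡-sym (paths-central m)))

  ℒπ-moments : ∀ n j → ℒπ n (λ i → a R (i ℕ.+ j)) ≈ _×_ R (paths j n) 1#
  ℒπ-moments zero          j = trans (*-identityˡ _) (a≈paths j)
  ℒπ-moments (suc zero)    j = begin
    - 1# * a R j + 1# * a R (suc j)
      ≈⟨ +-cong (*-congˡ (a≈paths j)) (*-congˡ (trans (a≈paths (suc j)) (×-homo-+ 1# (paths j 0) (paths j 1)))) ⟩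
    - 1# * P + 1# * (P + Q)               ≈⟨ solve 2 (λ P Q → :- one :* P :+ one :* (P :+ Q) := Q) refl P Q ⟩
    Q                                     ∎
    where
    P = _×_ R (paths j 0) 1#
    Q = _×_ R (paths j 1) 1#
    one = con (ℤ.+ 1)
  ℒπ-moments (suc (suc n)) j = begin
    ℒπ (suc (suc n)) (λ i → a R (i ℕ.+ j))                              ≈⟨ ℒπ-recurrence n _ ⟩
    ℒπ (suc n) (λ i → a R (suc i ℕ.+ j)) - ℒπ n (λ i → a R (i ℕ.+ j))
      ≈⟨ +-cong (trans (ℒπ-cong (suc n) λ i → reflexive (cong (a R) (≡-sym (ℕ.+-suc i j)))) (ℒπ-moments (suc n) (suc j)))
                (-‿cong (ℒπ-moments n j)) ⟩
    _×_ R (paths j n ℕ.+ paths j (suc (suc n))) 1# - P                  ≈⟨ +-congʳ (×-homo-+ 1# (paths j n) _) ⟩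
    (P + Q) - P                                                         ≈⟨ solve 2 (λ P Q → (P :+ Q) :- P := Q) refl P Q ⟩
    Q                                                                   ∎
    where
    P = _×_ R (paths j n) 1#
    Q = _×_ R (paths j (suc (suc n))) 1#

  ℒπ-orthogonal : ∀ n j → j ℕ.< n → ℒπ n (λ i → a R (i ℕ.+ j)) ≈ 0#
  ℒπ-orthogonal n j j<n = trans (ℒπ-moments n j) (reflexive (cong (λ k → _×_ R k 1#) (paths-< j<n)))

  ℒπ-normalised : ∀ n → ℒπ n (λ i → a R (i ℕ.+ n)) ≈ 1#
  ℒπ-normalised n = trans (ℒπ-moments n n) (trans (reflexive (cong (λ k → _×_ R k 1#) (paths-diagonal n))) (+-identityʳ 1#))

  hankel : ∀ n → Matrix n
  hankel n i j = a R (toℕ i ℕ.+ toℕ j)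

  borderedHankel : ∀ n → Vector Carrier (suc n) → Matrix (suc n)
  borderedHankel n v i j = if toℕ j <ᵇ n then a R (toℕ i ℕ.+ toℕ j) else v i

  borderedHankel-inject₁ : ∀ n v i (c : Fin n) → borderedHankel n v i (inject₁ c) ≡ a R (toℕ i ℕ.+ toℕ c)
  borderedHankel-inject₁ n v i c rewrite Fin.toℕ-inject₁ c with toℕ c <ᵇ n | ℕ.<⇒<ᵇ (Fin.toℕ<n c)
  ... | true | _ = ≡-refl

  borderedHankel-fromℕ : ∀ n v i → borderedHankel n v i (fromℕ n) ≡ v i
  borderedHankel-fromℕ n v i rewrite Fin.toℕ-fromℕ n with n <ᵇ n | ℕ.<ᵇ⇒< n n
  ... | false | _    = ≡-refl
  ... | true  | n<n = ⊥-elim (ℕ.<-irrefl ≡-refl (n<n _))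

  -- Adding to the last row the combination with coefficients πₙ clears it up to the corner.
  det-borderedHankel : ∀ n → det R n (hankel n) ≈ 1# → ∀ v →
                       det R (suc n) (borderedHankel n v) ≈ sumFin R (suc n) (λ t → π n (toℕ t) * v t)
  det-borderedHankel n det-hankel≈1 v = begin
    det R (suc n) M                                 ≈⟨ *-identityˡ _ ⟨
    1# * det R (suc n) M                            ≈⟨ *-congʳ (trans (reflexive (cong (π n) (Fin.toℕ-fromℕ n))) (π-leading n)) ⟨
    p L * det R (suc n) M                           ≈⟨ det-replaceRow-combination (suc n) M L p ⟨
    det R (suc n) M′                                ≈⟨ det-lastRow n M′ lastRow≈0 ⟩
    M′ L L * det R n (λ i j → M′ (inject₁ i) (inject₁ j))
      ≈⟨ *-cong corner (trans (det-cong n upperLeft) det-hankel≈1) ⟩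
    d * 1#                                          ≈⟨ *-identityʳ d ⟩
    d                                               ∎
    where
    M = borderedHankel n v
    L = fromℕ n
    p : Vector Carrier (suc n)
    p t = π n (toℕ t)
    M′ = M [ L ]≔ (λ c → sumFin R (suc n) (λ t → p t * M t c))
    d = sumFin R (suc n) (λ t → π n (toℕ t) * v t)
    M′L : ∀ c → M′ L c ≈ sumFin R (suc n) (λ t → p t * M t c)
    M′L = ≡⇒≋ (updateAt-updates L M)
    lastRow≈0 : ∀ c → M′ L (inject₁ c) ≈ 0#
    lastRow≈0 c = begin
      M′ L (inject₁ c)                                              ≈⟨ M′L (inject₁ c) ⟩
      sumFin R (suc n) (λ t → p t * M t (inject₁ c))
        ≈⟨ sumFin-cong (suc n) {g = λ t → π n (toℕ t) * a R (toℕ t ℕ.+ toℕ c)}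
                       (λ t → *-congˡ (reflexive (borderedHankel-inject₁ n v t c))) ⟩
      sumFin R (suc n) (λ t → π n (toℕ t) * a R (toℕ t ℕ.+ toℕ c))  ≈⟨ sumFin≈sumTo n (λ i → π n i * a R (i ℕ.+ toℕ c)) ⟩
      ℒπ n (λ i → a R (i ℕ.+ toℕ c))                                ≈⟨ ℒπ-orthogonal n (toℕ c) (Fin.toℕ<n c) ⟩
      0#                                                            ∎
    corner : M′ L L ≈ d
    corner = trans (M′L L) (sumFin-cong (suc n) {λ t → p t * M t L} λ t → *-congˡ (reflexive (borderedHankel-fromℕ n v t)))
    upperLeft : ∀ i j → M′ (inject₁ i) (inject₁ j) ≈ hankel n i j
    upperLeft i j = reflexive (≡-trans (cong (_$ inject₁ j) (updateAt-minimal (inject₁ i) L M (Fin.fromℕ≢inject₁ ∘ ≡-sym)))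
                                       (≡-trans (borderedHankel-inject₁ n v (inject₁ i) j)
                                                (cong (λ k → a R (k ℕ.+ toℕ j)) (Fin.toℕ-inject₁ i))))

  det-hankel : ∀ n → det R n (hankel n) ≈ 1#
  det-hankel zero    = refl
  det-hankel (suc m) = begin
    det R (suc m) (hankel (suc m))                               ≈⟨ det-cong (suc m) bordered ⟩
    det R (suc m) (borderedHankel m lastColumn)                  ≈⟨ det-borderedHankel m (det-hankel m) lastColumn ⟩
    sumFin R (suc m) (λ t → π m (toℕ t) * lastColumn t)          ≈⟨ sumFin≈sumTo m (λ i → π m i * a R (i ℕ.+ m)) ⟩
    ℒπ m (λ i → a R (i ℕ.+ m))                                   ≈⟨ ℒπ-normalised m ⟩
    1#                                                           ∎
    where
    lastColumn : Vector Carrier (suc m)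
    lastColumn i = a R (toℕ i ℕ.+ m)
    bordered : ∀ i j → hankel (suc m) i j ≈ borderedHankel m lastColumn i j
    bordered i j with toℕ j <ᵇ m in j<ᵇm
    ... | true  = refl
    ... | false = reflexive (cong (λ k → a R (toℕ i ℕ.+ k)) j≡m)
      where
      j≡m : toℕ j ≡ m
      j≡m = ℕ.≤-antisym (ℕ.s≤s⁻¹ (Fin.toℕ<n j)) (ℕ.≮⇒≥ λ j<m → subst T j<ᵇm (ℕ.<⇒<ᵇ j<m))

  -- Fₘ₊₁(1, s) with the summation extended from j ≤ ⌊m/2⌋ to j ≤ m; the extra terms vanish.
  fibSum : Carrier → ℕ → Carrier
  fibSum s m = sumTo R m (λ j → _×_ R ((m ∸ j) C j) (_^_ R s j))

  Fib≈fibSum : ∀ s m → Fib R (suc m) 1# s ≈ fibSum s m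
  Fib≈fibSum s m = begin
    sumTo R (m / 2) (λ j → _×_ R ((m ∸ j) C j) (_^_ R 1# (m ∸ 2 ℕ.* j) * _^_ R s j))
      ≈⟨ sumTo-cong (m / 2) (λ j _ → ×-congʳ ((m ∸ j) C j) (trans (*-congʳ (1^≈1 (m ∸ 2 ℕ.* j))) (*-identityˡ _))) ⟩
    sumTo R (m / 2) term                      ≈⟨ sumTo-vanishingTail m (m / 2) (m/n≤m m 2) vanish ⟨
    fibSum s m                                ∎
    where
    term : ℕ → Carrier
    term j = _×_ R ((m ∸ j) C j) (_^_ R s j)
    vanish : ∀ j → m / 2 ℕ.< j → j ℕ.≤ m → term j ≈ 0#
    vanish j m/2<j _ = reflexive (cong (λ k → _×_ R k (_^_ R s j))
      (k>n⇒nCk≡0 (⌊m/2⌋<j⇒m∸j<j m j (subst (ℕ._< j) (n/2≡⌊n/2⌋ m) m/2<j))))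

  fibSum-recurrence : ∀ s m → fibSum s (suc (suc m)) ≈ fibSum s (suc m) + s * fibSum s m
  fibSum-recurrence s m = begin
    fibSum s (suc (suc m))                                          ≈⟨ sumTo-suc (suc m) _ ⟩
    h + sumTo R (suc m) (λ j → _×_ R ((suc m ∸ j) C suc j) (_^_ R s (suc j)))
      ≈⟨ +-congˡ (sumTo-cong (suc m) λ j _ →
           trans (reflexive (cong (λ k → _×_ R k (_^_ R s (suc j))) ([1+m∸j]C[1+j] m j)))
                 (×-homo-+ (_^_ R s (suc j)) ((m ∸ j) C j) ((m ∸ j) C suc j))) ⟩
    h + sumTo R (suc m) (λ j → X j + Y j)                           ≈⟨ +-congˡ (sumTo-+ (suc m) X Y) ⟩
    h + ((sumTo R m X + X (suc m)) + (sumTo R m Y + Y (suc m)))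
      ≈⟨ +-congˡ (+-cong (sumTo-dropLast m (beyond m _)) (sumTo-dropLast m (beyond (suc m) _))) ⟩
    h + (sumTo R m X + sumTo R m Y)
      ≈⟨ +-congˡ (+-congʳ (trans (sumTo-cong m λ j _ → sym (×-comm-* ((m ∸ j) C j) s (_^_ R s j))) (sumTo-*ˡ m s _))) ⟩
    h + (s * fibSum s m + sumTo R m Y)                              ≈⟨ solve 3 (λ h a b → h :+ (a :+ b) := (h :+ b) :+ a) refl _ _ _ ⟩
    (h + sumTo R m Y) + s * fibSum s m                              ≈⟨ +-congʳ (sumTo-suc m _) ⟨
    fibSum s (suc m) + s * fibSum s m                               ∎
    where
    h = _×_ R (suc (suc m) C 0) 1#
    X Y : ℕ → Carrier
    X j = _×_ R ((m ∸ j) C j) (_^_ R s (suc j))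
    Y j = _×_ R ((m ∸ j) C suc j) (_^_ R s (suc j))
    beyond : ∀ k y → _×_ R ((m ∸ suc m) C suc k) y ≈ 0#
    beyond k y = reflexive (cong (λ n → _×_ R (n C suc k) y) (ℕ.m≤n⇒m∸n≡0 (ℕ.n≤1+n m)))

  Fib-recurrence : ∀ s n → Fib R (suc (suc n)) 1# s ≈ Fib R (suc n) 1# s + s * Fib R n 1# s
  Fib-recurrence s zero    = solve 1 (λ s → (one :* one) :* one :+ o := ((one :* one) :+ o) :+ s :* o) refl s
    where one = con (ℤ.+ 1); o = con (ℤ.+ 0)
  Fib-recurrence s (suc n) = begin
    Fib R (suc (suc (suc n))) 1# s                        ≈⟨ Fib≈fibSum s (suc (suc n)) ⟩
    fibSum s (suc (suc n))                                ≈⟨ fibSum-recurrence s n ⟩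
    fibSum s (suc n) + s * fibSum s n                     ≈⟨ +-cong (Fib≈fibSum s (suc n)) (*-congˡ (Fib≈fibSum s n)) ⟨
    Fib R (suc (suc n)) 1# s + s * Fib R (suc n) 1# s     ∎

  linearRecurrence-unique : ∀ s {u v : ℕ → Carrier} →
    (∀ n → u (suc (suc n)) ≈ u (suc n) + s * u n) → (∀ n → v (suc (suc n)) ≈ v (suc n) + s * v n) →
    u 0 ≈ v 0 → u 1 ≈ v 1 → ∀ n → u n ≈ v n
  linearRecurrence-unique s {u} {v} u-rec v-rec u₀≈v₀ u₁≈v₁ = go
    where
    go : ∀ n → u n ≈ v n
    go zero          = u₀≈v₀
    go (suc zero)    = u₁≈v₁
    go (suc (suc n)) = trans (u-rec n) (trans (+-cong (go (suc n)) (*-congˡ (go n))) (sym (v-rec n)))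

  module _ (x : Carrier) where

    private
      s : Carrier
      s = - (_^_ R x 2)

    fibonacciSide : ℕ → Carrier
    fibonacciSide n = Fib R (suc n) 1# s - x * Fib R n 1# s

    determinantSide : ℕ → Carrier
    determinantSide n = ℒπ n (λ i → _^_ R x (n ∸ i))

    fibonacciSide-recurrence : ∀ n → fibonacciSide (suc (suc n)) ≈ fibonacciSide (suc n) + s * fibonacciSide n
    fibonacciSide-recurrence n = begin
      fibonacciSide (suc (suc n))
        ≈⟨ +-cong (Fib-recurrence s (suc n)) (-‿cong (*-congˡ (Fib-recurrence s n))) ⟩
      (F₂ + s * F₁) - x * (F₁ + s * F₀)
        ≈⟨ solve 5 (λ x s F₀ F₁ F₂ → (F₂ :+ s :* F₁) :- x :* (F₁ :+ s :* F₀)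
                                    := (F₂ :- x :* F₁) :+ s :* (F₁ :- x :* F₀)) refl x s F₀ F₁ F₂ ⟩
      fibonacciSide (suc n) + s * fibonacciSide n ∎
      where
      F₀ = Fib R n 1# s
      F₁ = Fib R (suc n) 1# s
      F₂ = Fib R (suc (suc n)) 1# s

    determinantSide-recurrence : ∀ n → determinantSide (suc (suc n)) ≈ determinantSide (suc n) + s * determinantSide n
    determinantSide-recurrence n = begin
      determinantSide (suc (suc n))                                  ≈⟨ ℒπ-recurrence n _ ⟩
      determinantSide (suc n) - ℒπ n (λ i → _^_ R x (suc (suc n) ∸ i))
        ≈⟨ +-congˡ (-‿cong (trans (sumTo-cong n lower) (sumTo-*ˡ n (_^_ R x 2) _))) ⟩
      determinantSide (suc n) - _^_ R x 2 * determinantSide n       ≈⟨ +-congˡ (-‿distribˡ-* _ _) ⟩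
      determinantSide (suc n) + s * determinantSide n                ∎
      where
      lower : ∀ i → i ℕ.≤ n → π n i * _^_ R x (suc (suc n) ∸ i) ≈ _^_ R x 2 * (π n i * _^_ R x (n ∸ i))
      lower i i≤n rewrite ℕ.+-∸-assoc 2 i≤n =
        solve 3 (λ p x y → p :* (x :* (x :* y)) := (x :* (x :* con (ℤ.+ 1))) :* (p :* y)) refl _ _ _

    fibonacciSide≈determinantSide : ∀ n → fibonacciSide n ≈ determinantSide n
    fibonacciSide≈determinantSide = linearRecurrence-unique s fibonacciSide-recurrence determinantSide-recurrence
      (solve 1 (λ x → (one :* one :+ o) :- x :* o := one :* one) refl x)
      (solve 1 (λ x → ((one :* one) :* one :+ o) :- x :* (one :* one :+ o) := :- one :* (x :* one) :+ one :* one) refl x)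
      where one = con (ℤ.+ 1); o = con (ℤ.+ 0)


proposition3 : ∀ {c ℓ : Level} (R : CommutativeRing c ℓ) (k : ℕ) (x : CommutativeRing.Carrier R) →
    let open CommutativeRing R in
    Fib R (suc (suc k)) 1# (- (_^_ R x 2)) - x * Fib R (suc k) 1# (- (_^_ R x 2))
      ≈ det R (suc (suc k)) (hankelMatrix R k x)
-- hankelMatrix R k x is definitionally borderedHankel R (suc k) applied to the powers x ^ (k + 1 - i).
proposition3 R k x = begin
  fibonacciSide R x (suc k)                               ≈⟨ fibonacciSide≈determinantSide R x (suc k) ⟩
  determinantSide R x (suc k)                             ≈⟨ sumFin≈sumTo R (suc k) _ ⟨
  sumFin R (suc (suc k)) (λ t → π R (suc k) (toℕ t) * _^_ R x (suc k ∸ toℕ t))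
    ≈⟨ det-borderedHankel R (suc k) (det-hankel R (suc k)) (λ i → _^_ R x (suc k ∸ toℕ i)) ⟨
  det R (suc (suc k)) (hankelMatrix R k x)                ∎
  where
  open CommutativeRing R
  open import Relation.Binary.Reasoning.Setoid setoid
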